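{- Let $\mathcal{H}$ be the $6$-partite hypergraph whose vertices are pairs $(i,j)$ ($(i,j)$ being the $j$-th vertex of part $i$), with part $1$ equal to $\{(1,1),\dots,(1,6)\}$ and part $i$ equal to $\{(i,1),\dots,(i,5)\}$ for $2\le i\le 6$, and with the $13$ edges $E_1 =\{(1,1), (2,4), (3,4), (4,5), (5,3), (6,5)\}$, $E_2 =\{(1,2), (2,5), (3,2), (4,5), (5,5), (6,3)\}$, $E_3 =\{(1,3), (2,4), (3,5), (4,3), (5,4), (6,3)\}$, $E_4 =\{(1,4), (2,1), (3,5), (4,4), (5,5), (6,5)\}$, $E_5 =\{(1,4), (2,5), (3,4), (4,2), (5,4), (6,4)\}$, $E_6 =\{(1,5), (2,2), (3,5), (4,5), (5,1), (6,4)\}$, $E_7 =\{(1,5), (2,5), (3,1), (4,3), (5,2), (6,5)\}$, $E_8 =\{(1,5), (2,4), (3,3), (4,2), (5,5), (6,2)\}$, $E_9 =\{(1,5), (2,3), (3,4), (4,4), (5,3), (6,3)\}$, $E_{10} =\{(1,6), (2,2), (3,4), (4,3), (5,5), (6,1)\}$, $E_{11} =\{(1,6), (2,4), (3,2), (4,4), (5,2), (6,4)\}$, $E_{12} =\{(1,6), (2,5), (3,5), (4,1), (5,3), (6,2)\}$, $E_{13} =\{(1,6), (2,3), (3,3), (4,5), (5,4), (6,5)\}$. Then $\tau(\mathcal{H}) = 5$.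
   Context: $\tau(\mathcal{H})$ denotes the minimum size of a set of vertices of $\mathcal{H}$ meeting every edge of $\mathcal{H}$. -}

module Defs where

open import Data.Nat using (ℕ; _≤_)
open import Data.Fin using (Fin; zero; suc; #_)
open import Data.Product using (Σ; _×_; _,_; ∃)
open import Data.List using (List; []; _∷_; length)
open import Data.List.Relation.Unary.All using (All)
open import Data.List.Relation.Unary.Any using (Any)
open import Data.List.Relation.Unary.Unique.Propositional using (Unique)
open import Data.List.Membership.Propositional using (_∈_)
open import Relation.Binary.PropositionalEquality using (_≡_)

record Hypergraph : Set₁ where
  field
    V     : Set
    edges : List (List V)
open Hypergraph public

IsTransversal : (H : Hypergraph) → List (V H) → Set
IsTransversal H T = Unique T × All (λ e → Any (λ v → v ∈ T) e) (edges H)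

τ≡ : Hypergraph → ℕ → Set
τ≡ H k = (Σ (List (V H)) λ T → IsTransversal H T × length T ≡ k)
       × ((T : List (V H)) → IsTransversal H T → k ≤ length T)

-- The 6-partite hypergraph. Parts are indexed 0..5 (paper's parts 1..6);
-- part 0 has 6 vertices, the others 5. Vertex (i , j) here is the
-- paper's (i+1 , j+1).
partSize : Fin 6 → ℕ
partSize zero = 6
partSize (suc _) = 5

Vertex : Set
Vertex = Σ (Fin 6) (λ i → Fin (partSize i))

p1 p2 p3 p4 p5 p6 : Fin 6
p1 = zero
p2 = suc zero
p3 = suc (suc zero)
p4 = suc (suc (suc zero))
p5 = suc (suc (suc (suc zero)))
p6 = suc (suc (suc (suc (suc zero))))

edge : Fin 6 → Fin 5 → Fin 5 → Fin 5 → Fin 5 → Fin 5 → List Vertex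
edge a b c d e f =
  (p1 , a) ∷ (p2 , b) ∷ (p3 , c) ∷ (p4 , d) ∷ (p5 , e) ∷ (p6 , f) ∷ []

H : Hypergraph
H = record
  { V = Vertex
  ; edges =
      edge (# 0) (# 3) (# 3) (# 4) (# 2) (# 4)
    ∷ edge (# 1) (# 4) (# 1) (# 4) (# 4) (# 2)
    ∷ edge (# 2) (# 3) (# 4) (# 2) (# 3) (# 2)
    ∷ edge (# 3) (# 0) (# 4) (# 3) (# 4) (# 4)
    ∷ edge (# 3) (# 4) (# 3) (# 1) (# 3) (# 3)
    ∷ edge (# 4) (# 1) (# 4) (# 4) (# 0) (# 3)
    ∷ edge (# 4) (# 4) (# 0) (# 2) (# 1) (# 4)
    ∷ edge (# 4) (# 3) (# 2) (# 1) (# 4) (# 1)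
    ∷ edge (# 4) (# 2) (# 3) (# 3) (# 2) (# 2)
    ∷ edge (# 5) (# 1) (# 3) (# 2) (# 4) (# 0)
    ∷ edge (# 5) (# 3) (# 1) (# 3) (# 1) (# 3)
    ∷ edge (# 5) (# 4) (# 4) (# 0) (# 2) (# 1)
    ∷ edge (# 5) (# 2) (# 2) (# 4) (# 3) (# 4)
    ∷ []
  }

module Submission where

-- Upper bound: the five vertices (1,1), (1,4), (1,5), (1,6), (6,3) form a
-- transversal; the first four meet E1 and E4–E13, and (6,3) meets E2, E3.
--
-- Lower bound: a branching argument, valid for any finite hypergraph.  If
-- every transversal must meet the first edge e, then for each v ∈ e the
-- transversal minus v still meets all edges avoiding v.  Hence
-- "every transversal of Es has ≥ k+1 vertices" follows from "for every
-- v ∈ e, every transversal of the edges avoiding v has ≥ k vertices".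
-- Unfolding this recursion gives a decidable certificate 'LowerBound k Es';
-- we prove it sound for an arbitrary vertex type with decidable equality,
-- and let Agda decide the certificate 'LowerBound 5 (edges H)'.

open import Defs
open import Data.Nat using (ℕ; zero; suc; _≤_; z≤n; s≤s)
open import Data.Fin using (#_)
import Data.Fin.Properties as Fin
open import Data.Product using (_,_)
open import Data.Product.Properties using (≡-dec)
open import Data.Sum using (_⊎_; inj₁; inj₂; [_,_]′)
open import Data.Unit using (⊤; tt)
open import Data.Empty using (⊥; ⊥-elim)
open import Data.List using (List; []; _∷_; length; filter)
open import Data.List.Properties using (length-removeAt′)
open import Data.List.Relation.Unary.All using (All; []; _∷_; all?)
import Data.List.Relation.Unary.All as All
open import Data.List.Relation.Unary.All.Properties using (all-filter; filter⁺)
open import Data.List.Relation.Unary.Any using (Any; here; there; index; _─_; any?)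
open import Data.List.Relation.Unary.AllPairs using ([]; _∷_)
open import Data.List.Relation.Unary.Unique.Propositional using (Unique)
open import Data.List.Membership.Propositional using (_∈_; _∉_; find; lose)
import Data.List.Membership.DecPropositional as DecMembership
open import Relation.Binary using (DecidableEquality)
open import Relation.Binary.PropositionalEquality using (_≡_; refl; subst; sym)
open import Relation.Nullary using (Dec; yes; no; ¬?)
open import Relation.Nullary.Decidable using (toWitness)

module BranchingBound {A : Set} (_≟_ : DecidableEquality A) where

  open DecMembership _≟_ using (_∈?_)

  Hits : List A → List A → Set
  Hits T e = Any (_∈ T) e

  avoiding : A → List (List A) → List (List A)
  avoiding v = filter (λ e → ¬? (v ∈? e))

  LowerBound : ℕ → List (List A) → Set
  LowerBound zero    Es       = ⊤
  LowerBound (suc k) []       = ⊥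
  LowerBound (suc k) (e ∷ Es) = All (λ v → LowerBound k (avoiding v (e ∷ Es))) e

  lowerBound? : ∀ k Es → Dec (LowerBound k Es)
  lowerBound? zero    Es       = yes tt
  lowerBound? (suc k) []       = no (λ ())
  lowerBound? (suc k) (e ∷ Es) = all? (λ v → lowerBound? k (avoiding v (e ∷ Es))) e

  ∈-─ : ∀ {v w : A} {T : List A} (p : v ∈ T) → w ∈ T → w ≡ v ⊎ w ∈ (T ─ p)
  ∈-─ (here refl) (here refl) = inj₁ refl
  ∈-─ (here _)    (there q)   = inj₂ q
  ∈-─ (there p)   (here refl) = inj₂ (here refl)
  ∈-─ (there p)   (there q)   with ∈-─ p q
  ... | inj₁ w≡v = inj₁ w≡v
  ... | inj₂ w∈  = inj₂ (there w∈)

  hits-─ : ∀ {v : A} {T e : List A} (p : v ∈ T) → v ∉ e → Hits T e → Hits (T ─ p) e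
  hits-─ p v∉e hit with find hit
  ... | w , w∈e , w∈T = [ (λ { refl → ⊥-elim (v∉e w∈e) }) , lose w∈e ]′ (∈-─ p w∈T)

  hitsAll-avoiding : ∀ {v : A} {T : List A} Es (p : v ∈ T) →
                     All (Hits T) Es → All (Hits (T ─ p)) (avoiding v Es)
  hitsAll-avoiding {v} Es p hitsAll =
    All.zipWith (λ (v∉e , hit) → hits-─ p v∉e hit)
      (all-filter (λ e → ¬? (v ∈? e)) Es , filter⁺ (λ e → ¬? (v ∈? e)) hitsAll)

  lowerBound-sound : ∀ k Es → LowerBound k Es →
                     (T : List A) → All (Hits T) Es → k ≤ length T
  lowerBound-sound zero    Es       _     T _ = z≤n
  lowerBound-sound (suc k) (e ∷ Es) bound T hitsAll@(hitsE ∷ _)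
    with find hitsE
  ... | v , v∈e , v∈T =
    subst (suc k ≤_) (sym (length-removeAt′ T (index v∈T)))
      (s≤s (lowerBound-sound k (avoiding v (e ∷ Es)) (All.lookup bound v∈e)
             (T ─ v∈T) (hitsAll-avoiding (e ∷ Es) v∈T hitsAll)))

_≟V_ : DecidableEquality Vertex
_≟V_ = ≡-dec Fin._≟_ Fin._≟_

open BranchingBound _≟V_ using (LowerBound; lowerBound?; lowerBound-sound)
open DecMembership _≟V_ using (_∈?_)

T₅ : List Vertex
T₅ = (p1 , # 0) ∷ (p1 , # 3) ∷ (p1 , # 4) ∷ (p1 , # 5) ∷ (p6 , # 2) ∷ []

T₅-transversal : IsTransversal H T₅
T₅-transversal = distinct , toWitness {a? = all? (any? (_∈? T₅)) (edges H)} _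
  where
  distinct : Unique T₅
  distinct = ((λ ()) ∷ (λ ()) ∷ (λ ()) ∷ (λ ()) ∷ [])
           ∷ ((λ ()) ∷ (λ ()) ∷ (λ ()) ∷ [])
           ∷ ((λ ()) ∷ (λ ()) ∷ [])
           ∷ ((λ ()) ∷ [])
           ∷ [] ∷ []

H-lowerBound : LowerBound 5 (edges H)
H-lowerBound = toWitness {a? = lowerBound? 5 (edges H)} _

lemma4 : τ≡ H 5
lemma4 = (T₅ , T₅-transversal , refl)
       , λ T (_ , hitsAll) → lowerBound-sound 5 (edges H) H-lowerBound T hitsAll
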